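{- Let $X$ be a finite set with $n:=|X|\ge 2$. Then $$\max\{D(\succsim,\succsim'):\ \succsim,\succsim'\in\mathbb{P}_{\text{total}}(X)\}=n2^{n-1}+2-2^{\lfloor n/2\rfloor}-2^{\lceil n/2\rceil}.$$
   Context: $\mathbb{P}_{\text{total}}(X)$ is the set of total preorders on $X$, i.e. binary relations $\succsim$ on $X$ that are reflexive, transitive and total (for all $x,y$, $x\succsim y$ or $y\succsim x$). For such $\succsim$, $\succ$ is its asymmetric part ($x\succ y$ iff $x\succsim y$ and not $y\succsim x$), and for $S\subseteq X$, $M(S,\succsim):=\{x\in S:\text{there is no }y\in S\text{ with }y\succ x\}$. The top-difference semimetric is $D(\succsim,\trianglerighteq):=\sum_{S\subseteq X}|M(S,\succsim)\triangle M(S,\trianglerighteq)|$. -}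

module Defs where

open import Data.Bool using (Bool; true; false; _∧_; _∨_; not; _xor_; T)
open import Data.Nat using (ℕ; zero; suc; _+_; _*_; _∸_; _^_; ⌊_/2⌋; ⌈_/2⌉)
open import Data.Fin using (Fin)
open import Data.Vec using (Vec; []; _∷_; tabulate; lookup)
open import Data.List using (List; map; _++_; allFin)
open import Data.Bool.ListAction using (any)
open import Data.Nat.ListAction using (sum)
open import Data.Fin.Subset using (Subset; ∣_∣)
open import Relation.Binary.Structures using (IsTotalPreorder)
open import Relation.Binary.PropositionalEquality using (_≡_)

-- The finite set X with |X| = n is represented by Fin n.
-- A binary relation on X is a (decidable) Bool-valued relation; x ≿ y iff R x y ≡ true.
BRel : ℕ → Set
BRel n = Fin n → Fin n → Bool

IsTotalPre : ∀ {n} → BRel n → Set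
IsTotalPre {n} R = IsTotalPreorder {A = Fin n} _≡_ (λ x y → T (R x y))

strict : ∀ {n} → BRel n → Fin n → Fin n → Bool
strict R x y = R x y ∧ not (R y x)

M : ∀ {n} → Subset n → BRel n → Subset n
M {n} S R = tabulate λ x →
  lookup S x ∧ not (any (λ y → lookup S y ∧ strict R y x) (allFin n))

_△_ : ∀ {n} → Subset n → Subset n → Subset n
[] △ [] = []
(a ∷ A) △ (b ∷ B) = (a xor b) ∷ (A △ B)

allSubsets : (n : ℕ) → List (Subset n)
allSubsets zero = [] ∷ Data.List.[]
  where open import Data.List using (_∷_)
allSubsets (suc n) = map (true ∷_) (allSubsets n) ++ map (false ∷_) (allSubsets n)

D : ∀ {n} → BRel n → BRel n → ℕ
D {n} R Q = sum (map (λ S → ∣ M S R △ M S Q ∣) (allSubsets n))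

maxD : ℕ → ℕ
maxD n = n * 2 ^ (n ∸ 1) + 2 ∸ 2 ^ ⌊ n /2⌋ ∸ 2 ^ ⌈ n /2⌉

-- Both top sets M(S,≿) and M(S,⊵) lie in S, so S contributes at most |S| to D, and
-- Σ_S |S| = n 2^(n-1).  Let T be the top class of ≿.  A nonempty S loses at least one
-- from |S| when (i) S ⊆ T: a ⊵-maximal element of S is also ≿-maximal; (ii) S ∩ T = ∅
-- and S is ⊵-indifferent: a ≿-maximal element of S is also ⊵-maximal; or (iii) T ⊆ S
-- and S ∖ T is not ⊵-indifferent: an element of S ∖ T that is not ⊵-maximal there is
-- maximal for neither.  These cases are exclusive for nonempty S, and since S ↦ S ∖ T
-- maps the supersets of T bijectively onto the subsets of X ∖ T, counting them (with ∅
-- counted twice) gives D ≤ n 2^(n-1) + 2 - 2^|T| - 2^(n-|T|); convexity of 2^k finishes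
-- the bound.  It is attained by putting a class A of size ⌊n/2⌋ on top of ≿ and X ∖ A
-- on top of ⊵, each above a linear order: then S loses exactly one when it is a nonempty
-- subset of A or of X ∖ A, and nothing otherwise.

module Submission where

open import Defs
open import Data.Bool using (Bool; true; false; _∧_; not; T; if_then_else_)
open import Data.Bool.ListAction using (any)
open import Data.Bool.Properties using (T-∧; T-≡; T?)
open import Data.Nat using (ℕ; zero; suc; _+_; _*_; _∸_; _^_; _≤_; _<_; z≤n; s≤s; _≤ᵇ_; ⌊_/2⌋; ⌈_/2⌉)
open import Data.Nat.Properties
open import Data.Fin using (Fin; toℕ)
open import Data.Fin.Properties using (¬∀⟶∃¬; toℕ<n; toℕ-injective)
open import Data.Fin.Subset
open import Data.Fin.Subset.Properties
open import Data.Vec using ([]; _∷_; lookup; here; there)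
open import Data.Vec.Properties using ([]=⇒lookup; lookup⇒[]=; lookup∘tabulate)
open import Data.List using (List; []; _∷_; map; _++_; allFin)
open import Data.List.Relation.Unary.Any as Any using (satisfied)
open import Data.List.Relation.Unary.Any.Properties using (any⁺; any⁻)
open import Data.List.Membership.Propositional as List using (lose)
open import Data.List.Membership.Propositional.Properties using (∈-allFin)
open import Data.List.Properties using (map-++; map-∘)
open import Data.Nat.ListAction using (sum)
open import Data.Nat.ListAction.Properties using (sum-++)
open import Data.Product using (Σ; _×_; _,_; proj₁; proj₂; ∃)
open import Data.Sum as Sum using (inj₁; inj₂)
open import Data.Empty using (⊥-elim)
open import Data.Unit using (tt)
open import Function using (_∘_; _⇔_; mk⇔; Equivalence)
open import Relation.Nullary using (¬_; Dec; yes; no; does; contradiction; ¬?; _×-dec_; _→-dec_)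
open import Relation.Nullary.Decidable using (decidable-stable)
open import Relation.Unary using (Decidable)
open import Relation.Binary.Structures using (IsTotalPreorder)
open import Relation.Binary.PropositionalEquality
open import Data.Nat.Tactic.RingSolver using (solve-∀)
open import Algebra.Properties.CommutativeSemigroup +-commutativeSemigroup using (interchange)

private
  variable
    n : ℕ

𝟙[_] : ∀ {P : Set} → Dec P → ℕ
𝟙[ P? ] = if does P? then 1 else 0

𝟙≤1 : ∀ {P : Set} (P? : Dec P) → 𝟙[ P? ] ≤ 1
𝟙≤1 (yes _) = ≤-refl
𝟙≤1 (no _) = z≤n

𝟙-no : ∀ {P : Set} → ¬ P → (P? : Dec P) → 𝟙[ P? ] ≡ 0
𝟙-no ¬p (yes p) = contradiction p ¬p
𝟙-no ¬p (no _) = refl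

𝟙-×-split : ∀ {P Q : Set} (P? : Dec P) (Q? : Dec Q) →
  𝟙[ P? ×-dec Q? ] + 𝟙[ P? ×-dec ¬? Q? ] ≡ 𝟙[ P? ]
𝟙-×-split (yes _) (yes _) = refl
𝟙-×-split (yes _) (no _) = refl
𝟙-×-split (no _) _ = refl

module _ {p q : Subset n} where

  p⊈q⇒∃∈p∉q : ¬ (p ⊆ q) → ∃ λ x → x ∈ p × x ∉ q
  p⊈q⇒∃∈p∉q p⊈q with ¬∀⟶∃¬ n (λ x → x ∈ p → x ∈ q) (λ x → x ∈? p →-dec x ∈? q) (λ h → p⊈q (h _))
  ... | x , ¬[x∈p⇒x∈q] with x ∈? p
  ...   | yes x∈p = x , x∈p , ¬[x∈p⇒x∈q] ∘ λ x∈q _ → x∈q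
  ...   | no x∉p = contradiction (λ x∈p → contradiction x∈p x∉p) ¬[x∈p⇒x∈q]

x∈p─q⇒x∉q : ∀ {x : Fin n} (p q : Subset n) → x ∈ p ─ q → x ∉ q
x∈p─q⇒x∉q (_ ∷ p) (outside ∷ q) here ()
x∈p─q⇒x∉q (_ ∷ p) (_ ∷ q) (there x∈p─q) (there x∈q) = x∈p─q⇒x∉q p q x∈p─q x∈q

∣p∪q∣≤∣p∣+∣q∣ : ∀ (p q : Subset n) → ∣ p ∪ q ∣ ≤ ∣ p ∣ + ∣ q ∣
∣p∪q∣≤∣p∣+∣q∣ [] [] = z≤n
∣p∪q∣≤∣p∣+∣q∣ (inside ∷ p) (inside ∷ q) = s≤s (≤-trans (∣p∪q∣≤∣p∣+∣q∣ p q) (+-monoʳ-≤ ∣ p ∣ (n≤1+n ∣ q ∣)))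
∣p∪q∣≤∣p∣+∣q∣ (inside ∷ p) (outside ∷ q) = s≤s (∣p∪q∣≤∣p∣+∣q∣ p q)
∣p∪q∣≤∣p∣+∣q∣ (outside ∷ p) (inside ∷ q) = ≤-trans (s≤s (∣p∪q∣≤∣p∣+∣q∣ p q)) (≤-reflexive (sym (+-suc ∣ p ∣ ∣ q ∣)))
∣p∪q∣≤∣p∣+∣q∣ (outside ∷ p) (outside ∷ q) = ∣p∪q∣≤∣p∣+∣q∣ p q

∣p∣≤1 : ∀ {n} (p : Subset n) → (∀ {x y} → x ∈ p → y ∈ p → x ≡ y) → ∣ p ∣ ≤ 1
∣p∣≤1 {n} p unique with nonempty? p
... | yes (x , x∈p) = ≤-trans (p⊆q⇒∣p∣≤∣q∣ p⊆⁅x⁆) (≤-reflexive (∣⁅x⁆∣≡1 x))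
  where
  p⊆⁅x⁆ : p ⊆ ⁅ x ⁆
  p⊆⁅x⁆ y∈p = subst (_∈ ⁅ x ⁆) (unique x∈p y∈p) (x∈⁅x⁆ x)
... | no empty = ≤-trans (p⊆q⇒∣p∣≤∣q∣ {q = ⊥} (λ x∈p → contradiction (_ , x∈p) empty)) (≤-trans (≤-reflexive (∣⊥∣≡0 n)) z≤n)

∣p∣+∣∁p∣≡n : ∀ (p : Subset n) → ∣ p ∣ + ∣ ∁ p ∣ ≡ n
∣p∣+∣∁p∣≡n p = trans (cong (∣ p ∣ +_) (∣∁p∣≡n∸∣p∣ p)) (m+[n∸m]≡n (∣p∣≤n p))

x∈p∧x∉q⇒x∈p△q : ∀ {x : Fin n} {p q : Subset n} → x ∈ p → x ∉ q → x ∈ p △ q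
x∈p∧x∉q⇒x∈p△q {p = inside ∷ _} {outside ∷ _} here _ = here
x∈p∧x∉q⇒x∈p△q {p = inside ∷ _} {inside ∷ _} here x∉q = contradiction here x∉q
x∈p∧x∉q⇒x∈p△q {p = _ ∷ _} {_ ∷ _} (there x∈p) x∉q = there (x∈p∧x∉q⇒x∈p△q x∈p (x∉q ∘ there))

x∉p∧x∈q⇒x∈p△q : ∀ {x : Fin n} {p q : Subset n} → x ∉ p → x ∈ q → x ∈ p △ q
x∉p∧x∈q⇒x∈p△q {p = outside ∷ _} {inside ∷ _} _ here = here
x∉p∧x∈q⇒x∈p△q {p = inside ∷ _} {inside ∷ _} x∉p here = contradiction here x∉p
x∉p∧x∈q⇒x∈p△q {p = _ ∷ _} {_ ∷ _} x∉p (there x∈q) = there (x∉p∧x∈q⇒x∈p△q (x∉p ∘ there) x∈q)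

x∈p∧x∈q⇒x∉p△q : ∀ {x : Fin n} {p q : Subset n} → x ∈ p → x ∈ q → x ∉ p △ q
x∈p∧x∈q⇒x∉p△q {p = inside ∷ _} {inside ∷ _} here here ()
x∈p∧x∈q⇒x∉p△q {p = _ ∷ _} {_ ∷ _} (there x∈p) (there x∈q) (there x∈p△q) = x∈p∧x∈q⇒x∉p△q x∈p x∈q x∈p△q

x∉p∧x∉q⇒x∉p△q : ∀ {x : Fin n} {p q : Subset n} → x ∉ p → x ∉ q → x ∉ p △ q
x∉p∧x∉q⇒x∉p△q {p = inside ∷ _} {outside ∷ _} x∉p _ here = x∉p here
x∉p∧x∉q⇒x∉p△q {p = outside ∷ _} {inside ∷ _} _ x∉q here = x∉q here
x∉p∧x∉q⇒x∉p△q {p = _ ∷ _} {_ ∷ _} x∉p x∉q (there x∈p△q) = x∉p∧x∉q⇒x∉p△q (x∉p ∘ there) (x∉q ∘ there) x∈p△q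

x∈p△q⇒x∈p∪q : ∀ {x : Fin n} {p q : Subset n} → x ∈ p △ q → x ∈ p ∪ q
x∈p△q⇒x∈p∪q {p = inside ∷ _} {outside ∷ _} here = here
x∈p△q⇒x∈p∪q {p = outside ∷ _} {inside ∷ _} here = here
x∈p△q⇒x∈p∪q {p = _ ∷ _} {_ ∷ _} (there x∈p△q) = there (x∈p△q⇒x∈p∪q x∈p△q)

module _ {p q s : Subset n} where

  s⊆p⇒∣s∣≤∣q∣+∣p△q∣ : s ⊆ p → ∣ s ∣ ≤ ∣ q ∣ + ∣ p △ q ∣
  s⊆p⇒∣s∣≤∣q∣+∣p△q∣ s⊆p = ≤-trans (p⊆q⇒∣p∣≤∣q∣ s⊆q∪p△q) (∣p∪q∣≤∣p∣+∣q∣ q (p △ q))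
    where
    s⊆q∪p△q : s ⊆ q ∪ p △ q
    s⊆q∪p△q {x} x∈s with x ∈? q
    ... | yes x∈q = x∈p∪q⁺ (inj₁ x∈q)
    ... | no x∉q = x∈p∪q⁺ (inj₂ (x∈p∧x∉q⇒x∈p△q (s⊆p x∈s) x∉q))

  s⊆q⇒∣s∣≤∣p∣+∣p△q∣ : s ⊆ q → ∣ s ∣ ≤ ∣ p ∣ + ∣ p △ q ∣
  s⊆q⇒∣s∣≤∣p∣+∣p△q∣ s⊆q = ≤-trans (p⊆q⇒∣p∣≤∣q∣ s⊆p∪p△q) (∣p∪q∣≤∣p∣+∣q∣ p (p △ q))
    where
    s⊆p∪p△q : s ⊆ p ∪ p △ q
    s⊆p∪p△q {x} x∈s with x ∈? p
    ... | yes x∈p = x∈p∪q⁺ (inj₁ x∈p)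
    ... | no x∉p = x∈p∪q⁺ (inj₂ (x∉p∧x∈q⇒x∈p△q x∉p (s⊆q x∈s)))

module _ {p q s : Subset n} (p⊆s : p ⊆ s) (q⊆s : q ⊆ s) where

  p△q⊆s : p △ q ⊆ s
  p△q⊆s x∈p△q with x∈p∪q⁻ p q (x∈p△q⇒x∈p∪q x∈p△q)
  ... | inj₁ x∈p = p⊆s x∈p
  ... | inj₂ x∈q = q⊆s x∈q

  ∣p△q∣<∣s∣ : ∀ {x} → x ∈ s → x ∉ p △ q → ∣ p △ q ∣ < ∣ s ∣
  ∣p△q∣<∣s∣ x∈s x∉p△q = p⊂q⇒∣p∣<∣q∣ (p△q⊆s , _ , x∈s , x∉p△q)

sumSubsets : (Subset n → ℕ) → ℕ
sumSubsets {zero} f = f []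
sumSubsets {suc n} f = sumSubsets (f ∘ (inside ∷_)) + sumSubsets (f ∘ (outside ∷_))

sum-map-allSubsets : ∀ n (f : Subset n → ℕ) → sum (map f (allSubsets n)) ≡ sumSubsets f
sum-map-allSubsets zero f = +-identityʳ (f [])
sum-map-allSubsets (suc n) f = begin
  sum (map f (map (inside ∷_) L ++ map (outside ∷_) L))
    ≡⟨ cong sum (map-++ f (map (inside ∷_) L) (map (outside ∷_) L)) ⟩
  sum (map f (map (inside ∷_) L) ++ map f (map (outside ∷_) L))
    ≡⟨ sum-++ (map f (map (inside ∷_) L)) (map f (map (outside ∷_) L)) ⟩
  sum (map f (map (inside ∷_) L)) + sum (map f (map (outside ∷_) L))
    ≡⟨ cong₂ _+_ (cong sum (sym (map-∘ L))) (cong sum (sym (map-∘ L))) ⟩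
  sum (map (f ∘ (inside ∷_)) L) + sum (map (f ∘ (outside ∷_)) L)
    ≡⟨ cong₂ _+_ (sum-map-allSubsets n _) (sum-map-allSubsets n _) ⟩
  sumSubsets f ∎
  where
  open ≡-Reasoning
  L = allSubsets n

sumSubsets-cong : ∀ {f g : Subset n → ℕ} → (∀ S → f S ≡ g S) → sumSubsets f ≡ sumSubsets g
sumSubsets-cong {zero} f≗g = f≗g []
sumSubsets-cong {suc n} f≗g = cong₂ _+_ (sumSubsets-cong (f≗g ∘ (inside ∷_))) (sumSubsets-cong (f≗g ∘ (outside ∷_)))

sumSubsets-mono-≤ : ∀ {f g : Subset n → ℕ} → (∀ S → f S ≤ g S) → sumSubsets f ≤ sumSubsets g
sumSubsets-mono-≤ {zero} f≤g = f≤g []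
sumSubsets-mono-≤ {suc n} f≤g = +-mono-≤ (sumSubsets-mono-≤ (f≤g ∘ (inside ∷_))) (sumSubsets-mono-≤ (f≤g ∘ (outside ∷_)))

sumSubsets-+ : ∀ (f g : Subset n → ℕ) → sumSubsets (λ S → f S + g S) ≡ sumSubsets f + sumSubsets g
sumSubsets-+ {zero} f g = refl
sumSubsets-+ {suc n} f g = trans
  (cong₂ _+_ (sumSubsets-+ (f ∘ (inside ∷_)) (g ∘ (inside ∷_))) (sumSubsets-+ (f ∘ (outside ∷_)) (g ∘ (outside ∷_))))
  (interchange (sumSubsets (f ∘ (inside ∷_))) _ _ _)

sumSubsets-*ˡ : ∀ c (f : Subset n → ℕ) → sumSubsets (λ S → c * f S) ≡ c * sumSubsets f
sumSubsets-*ˡ {zero} c f = refl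
sumSubsets-*ˡ {suc n} c f = trans
  (cong₂ _+_ (sumSubsets-*ˡ c (f ∘ (inside ∷_))) (sumSubsets-*ˡ c (f ∘ (outside ∷_))))
  (sym (*-distribˡ-+ c _ _))

sumSubsets-const : ∀ n c → sumSubsets {n} (λ _ → c) ≡ 2 ^ n * c
sumSubsets-const zero c = sym (+-identityʳ c)
sumSubsets-const (suc n) c = begin
  sumSubsets {n} (λ _ → c) + sumSubsets {n} (λ _ → c) ≡⟨ cong (λ s → s + s) (sumSubsets-const n c) ⟩
  2 ^ n * c + 2 ^ n * c                               ≡⟨ cong (2 ^ n * c +_) (sym (+-identityʳ (2 ^ n * c))) ⟩
  2 * (2 ^ n * c)                                     ≡⟨ sym (*-assoc 2 (2 ^ n) c) ⟩
  2 ^ suc n * c ∎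
  where open ≡-Reasoning

sumSubsets-0 : sumSubsets {n} (λ _ → 0) ≡ 0
sumSubsets-0 {n} = trans (sumSubsets-const n 0) (*-zeroʳ (2 ^ n))

sumSubsets-⊆ : ∀ (T : Subset n) → sumSubsets (λ S → 𝟙[ S ⊆? T ]) ≡ 2 ^ ∣ T ∣
sumSubsets-⊆ [] = refl
sumSubsets-⊆ (inside ∷ T) = begin
  sumSubsets (λ S → 𝟙[ S ⊆? T ]) + sumSubsets (λ S → 𝟙[ S ⊆? T ])
    ≡⟨ cong (λ s → s + s) (sumSubsets-⊆ T) ⟩
  2 ^ ∣ T ∣ + 2 ^ ∣ T ∣
    ≡⟨ cong (2 ^ ∣ T ∣ +_) (sym (+-identityʳ (2 ^ ∣ T ∣))) ⟩
  2 ^ suc ∣ T ∣ ∎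
  where open ≡-Reasoning
sumSubsets-⊆ {suc n} (outside ∷ T) = cong₂ _+_ (sumSubsets-0 {n}) (sumSubsets-⊆ T)

-- S ↦ S ─ T maps the supersets of T bijectively onto the subsets of ∁ T.
sumSubsets-⊆∁-shift : ∀ (T : Subset n) {P : Subset n → Set} (P? : Decidable P) →
  sumSubsets (λ S → 𝟙[ S ⊆? ∁ T ×-dec P? S ]) ≡ sumSubsets (λ S → 𝟙[ T ⊆? S ×-dec P? (S ─ T) ])
sumSubsets-⊆∁-shift [] P? = refl
sumSubsets-⊆∁-shift {suc n} (inside ∷ T) P? = begin
  ∑ (λ _ → 0) + ∑ (λ S → 𝟙[ S ⊆? ∁ T ×-dec P? (outside ∷ S) ])
    ≡⟨ cong₂ _+_ (sumSubsets-0 {n}) (sumSubsets-⊆∁-shift T (P? ∘ (outside ∷_))) ⟩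
  ∑ (λ S → 𝟙[ T ⊆? S ×-dec P? (outside ∷ (S ─ T)) ])
    ≡⟨ sym (+-identityʳ _) ⟩
  ∑ (λ S → 𝟙[ T ⊆? S ×-dec P? (outside ∷ (S ─ T)) ]) + 0
    ≡⟨ cong (∑ (λ S → 𝟙[ T ⊆? S ×-dec P? (outside ∷ (S ─ T)) ]) +_) (sym (sumSubsets-0 {n})) ⟩
  ∑ (λ S → 𝟙[ T ⊆? S ×-dec P? (outside ∷ (S ─ T)) ]) + ∑ (λ _ → 0) ∎
  where
  open ≡-Reasoning
  ∑ : (Subset n → ℕ) → ℕ
  ∑ = sumSubsets
sumSubsets-⊆∁-shift (outside ∷ T) P? =
  cong₂ _+_ (sumSubsets-⊆∁-shift T (P? ∘ (inside ∷_))) (sumSubsets-⊆∁-shift T (P? ∘ (outside ∷_)))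

sumSubsets-⊆∁-⊇ : ∀ (T : Subset n) {P : Subset n → Set} (P? : Decidable P) →
  sumSubsets (λ S → 𝟙[ S ⊆? ∁ T ×-dec P? S ]) + sumSubsets (λ S → 𝟙[ T ⊆? S ×-dec ¬? (P? (S ─ T)) ])
    ≡ 2 ^ ∣ ∁ T ∣
sumSubsets-⊆∁-⊇ T P? = begin
  ∑ (λ S → 𝟙[ S ⊆? ∁ T ×-dec P? S ]) + ∑ (λ S → 𝟙[ T ⊆? S ×-dec ¬? (P? (S ─ T)) ])
    ≡⟨ cong (∑ (λ S → 𝟙[ S ⊆? ∁ T ×-dec P? S ]) +_) (sym (sumSubsets-⊆∁-shift T (¬? ∘ P?))) ⟩
  ∑ (λ S → 𝟙[ S ⊆? ∁ T ×-dec P? S ]) + ∑ (λ S → 𝟙[ S ⊆? ∁ T ×-dec ¬? (P? S) ])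
    ≡⟨ sym (sumSubsets-+ (λ S → 𝟙[ S ⊆? ∁ T ×-dec P? S ]) (λ S → 𝟙[ S ⊆? ∁ T ×-dec ¬? (P? S) ])) ⟩
  ∑ (λ S → 𝟙[ S ⊆? ∁ T ×-dec P? S ] + 𝟙[ S ⊆? ∁ T ×-dec ¬? (P? S) ])
    ≡⟨ sumSubsets-cong (λ S → 𝟙-×-split (S ⊆? ∁ T) (P? S)) ⟩
  ∑ (λ S → 𝟙[ S ⊆? ∁ T ])
    ≡⟨ sumSubsets-⊆ (∁ T) ⟩
  2 ^ ∣ ∁ T ∣ ∎
  where
  open ≡-Reasoning
  ∑ = sumSubsets

sumSubsets-2*𝟙[⊆⊥] : sumSubsets {n} (λ S → 2 * 𝟙[ S ⊆? ⊥ ]) ≡ 2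
sumSubsets-2*𝟙[⊆⊥] {n} = begin
  sumSubsets {n} (λ S → 2 * 𝟙[ S ⊆? ⊥ ]) ≡⟨ sumSubsets-*ˡ {n} 2 (λ S → 𝟙[ S ⊆? ⊥ ]) ⟩
  2 * sumSubsets {n} (λ S → 𝟙[ S ⊆? ⊥ ]) ≡⟨ cong (2 *_) (trans (sumSubsets-⊆ (⊥ {n})) (cong (2 ^_) (∣⊥∣≡0 n))) ⟩
  2 ∎
  where open ≡-Reasoning

sumSubsets-size : ∀ m → sumSubsets {suc m} ∣_∣ ≡ suc m * 2 ^ m
sumSubsets-size zero = refl
sumSubsets-size (suc m) = begin
  sumSubsets {suc m} (λ S → 1 + ∣ S ∣) + sumSubsets {suc m} ∣_∣
    ≡⟨ cong (_+ sumSubsets {suc m} ∣_∣) (sumSubsets-+ {suc m} (λ _ → 1) ∣_∣) ⟩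
  (sumSubsets {suc m} (λ _ → 1) + sumSubsets {suc m} ∣_∣) + sumSubsets {suc m} ∣_∣
    ≡⟨ cong₂ (λ a b → (a + b) + b) (trans (sumSubsets-const (suc m) 1) (*-identityʳ (2 ^ suc m))) (sumSubsets-size m) ⟩
  (2 * 2 ^ m + suc m * 2 ^ m) + suc m * 2 ^ m
    ≡⟨ doubling m (2 ^ m) ⟩
  suc (suc m) * 2 ^ suc m ∎
  where
  open ≡-Reasoning
  doubling : ∀ m p → (2 * p + suc m * p) + suc m * p ≡ suc (suc m) * (2 * p)
  doubling = solve-∀

T-not⇔¬T : ∀ {b} → T (not b) ⇔ (¬ T b)
T-not⇔¬T {true} = mk⇔ (λ ()) (λ ¬t → ¬t tt)
T-not⇔¬T {false} = mk⇔ (λ _ ()) (λ _ → tt)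

x∈p⇔T[p[x]] : ∀ {x : Fin n} {p : Subset n} → x ∈ p ⇔ T (lookup p x)
x∈p⇔T[p[x]] {x = x} {p} = mk⇔
  (λ x∈p → subst T (sym ([]=⇒lookup x∈p)) tt)
  (λ t → lookup⇒[]= x p (Equivalence.to T-≡ t))

module _ (R : BRel n) {S : Subset n} {x : Fin n} where

  private
    beats : Fin n → Bool
    beats y = lookup S y ∧ strict R y x

    lookup-M : lookup (M S R) x ≡ lookup S x ∧ not (any beats (allFin n))
    lookup-M = lookup∘tabulate _ x

  x∈M⇔ : x ∈ M S R ⇔ (x ∈ S × (∀ {y} → y ∈ S → ¬ T (strict R y x)))
  x∈M⇔ = mk⇔ to from
    where
    to : x ∈ M S R → x ∈ S × (∀ {y} → y ∈ S → ¬ T (strict R y x))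
    to x∈M with Equivalence.to T-∧ (subst T lookup-M (Equivalence.to x∈p⇔T[p[x]] x∈M))
    ... | Sx , unbeaten = Equivalence.from x∈p⇔T[p[x]] Sx , λ {y} y∈S y≻x →
      Equivalence.to T-not⇔¬T unbeaten
        (any⁺ beats (lose (∈-allFin y) (Equivalence.from T-∧ (Equivalence.to x∈p⇔T[p[x]] y∈S , y≻x))))
    from : x ∈ S × (∀ {y} → y ∈ S → ¬ T (strict R y x)) → x ∈ M S R
    from (x∈S , unbeaten) = Equivalence.from x∈p⇔T[p[x]] (subst T (sym lookup-M)
      (Equivalence.from T-∧ (Equivalence.to x∈p⇔T[p[x]] x∈S , Equivalence.from T-not⇔¬T noneBeats)))
      where
      noneBeats : ¬ T (any beats (allFin n))
      noneBeats t with satisfied (any⁻ beats (allFin n) t)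
      ... | y , Sy∧y≻x with Equivalence.to T-∧ Sy∧y≻x
      ...   | Sy , y≻x = unbeaten (Equivalence.from x∈p⇔T[p[x]] Sy) y≻x

M⊆ : ∀ (R : BRel n) S → M S R ⊆ S
M⊆ R S x∈M = proj₁ (Equivalence.to (x∈M⇔ R {S}) x∈M)

module MaximalElements {R : BRel n} (isTotalPre : IsTotalPre R) where

  open IsTotalPreorder isTotalPre using (total) renaming (refl to R-refl; trans to R-trans)

  ¬Rxy⇒Ryx : ∀ {x y} → ¬ T (R x y) → T (R y x)
  ¬Rxy⇒Ryx {x} {y} ¬Rxy with total x y
  ... | inj₁ Rxy = contradiction Rxy ¬Rxy
  ... | inj₂ Ryx = Ryx

  ¬strict⇔ : ∀ {x y} → (¬ T (strict R y x)) ⇔ T (R x y)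
  ¬strict⇔ {x} {y} = mk⇔
    (λ ¬y≻x → decidable-stable (T? (R x y)) λ ¬Rxy →
      ¬y≻x (Equivalence.from T-∧ (¬Rxy⇒Ryx ¬Rxy , Equivalence.from T-not⇔¬T ¬Rxy)))
    (λ Rxy y≻x → Equivalence.to T-not⇔¬T (proj₂ (Equivalence.to T-∧ y≻x)) Rxy)

  M-intro : ∀ {S x} → x ∈ S → (∀ {y} → y ∈ S → T (R x y)) → x ∈ M S R
  M-intro x∈S x≿S = Equivalence.from (x∈M⇔ R) (x∈S , Equivalence.from ¬strict⇔ ∘ x≿S)

  M-maximal : ∀ {S x y} → x ∈ M S R → y ∈ S → T (R x y)
  M-maximal x∈M y∈S = Equivalence.to ¬strict⇔ (proj₂ (Equivalence.to (x∈M⇔ R) x∈M) y∈S)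

  M-antitone : ∀ {U S x} → U ⊆ S → x ∈ U → x ∈ M S R → x ∈ M U R
  M-antitone U⊆S x∈U x∈M = M-intro x∈U (M-maximal x∈M ∘ U⊆S)

  private
    maximum : ∀ (xs : List (Fin n)) {S x} → x ∈ S →
      ∃ λ m → m ∈ S × (∀ {y} → y List.∈ xs → y ∈ S → T (R m y))
    maximum [] x∈S = _ , x∈S , λ ()
    maximum (z ∷ zs) {S} x∈S with maximum zs x∈S | z ∈? S
    ... | m , m∈S , m≿zs | no z∉S = m , m∈S , λ where
      (Any.here refl) z∈S → contradiction z∈S z∉S
      (Any.there y∈zs) → m≿zs y∈zs
    ... | m , m∈S , m≿zs | yes z∈S with T? (R m z)
    ...   | yes Rmz = m , m∈S , λ where
      (Any.here refl) _ → Rmz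
      (Any.there y∈zs) → m≿zs y∈zs
    ...   | no ¬Rmz = z , z∈S , λ where
      (Any.here refl) _ → R-refl
      (Any.there y∈zs) y∈S → R-trans (¬Rxy⇒Ryx ¬Rmz) (m≿zs y∈zs y∈S)

  M-nonempty : ∀ {S x} → x ∈ S → Nonempty (M S R)
  M-nonempty x∈S with maximum (allFin _) x∈S
  ... | m , m∈S , m≿S = m , M-intro m∈S (m≿S (∈-allFin _))

disagreement : BRel n → BRel n → Subset n → ℕ
disagreement R Q S = ∣ M S R △ M S Q ∣

disagreement≤ : ∀ (R Q : BRel n) S → disagreement R Q S ≤ ∣ S ∣
disagreement≤ R Q S = p⊆q⇒∣p∣≤∣q∣ (p△q⊆s (M⊆ R S) (M⊆ Q S))

disagreement< : ∀ (R Q : BRel n) {S x} → x ∈ S → x ∉ M S R △ M S Q → disagreement R Q S < ∣ S ∣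
disagreement< R Q {S} = ∣p△q∣<∣s∣ (M⊆ R S) (M⊆ Q S)

D≡sumSubsets-disagreement : ∀ (R Q : BRel n) → D R Q ≡ sumSubsets (disagreement R Q)
D≡sumSubsets-disagreement {n} R Q = sum-map-allSubsets n (disagreement R Q)

Indifferent : BRel n → Subset n → Set
Indifferent Q U = U ⊆ M U Q

indifferent? : ∀ (Q : BRel n) → Decidable (Indifferent Q)
indifferent? Q U = U ⊆? M U Q

Empty⇒Indifferent : ∀ {Q : BRel n} {U} → Empty U → Indifferent Q U
Empty⇒Indifferent empty x∈U = contradiction (_ , x∈U) empty

module UpperBound {R Q : BRel n} (R-total : IsTotalPre R) (Q-total : IsTotalPre Q) where

  private
    module ℛ = MaximalElements R-total
    module 𝒬 = MaximalElements Q-total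
    open IsTotalPreorder R-total using () renaming (trans to R-trans)

  Top : Subset n
  Top = M ⊤ R

  Top-greatest : ∀ {t y} → t ∈ Top → T (R t y)
  Top-greatest t∈Top = ℛ.M-maximal t∈Top ∈⊤

  Top-nonempty : Fin n → Nonempty Top
  Top-nonempty x = ℛ.M-nonempty (∈⊤ {x = x})

  M⊆Top : ∀ {S} → Top ⊆ S → M S R ⊆ Top
  M⊆Top Top⊆S {x} x∈M = let (t , t∈Top) = Top-nonempty x in
    ℛ.M-intro ∈⊤ λ _ → R-trans (ℛ.M-maximal x∈M (Top⊆S t∈Top)) (Top-greatest t∈Top)

  disagreement<-⊆Top : ∀ {S x} → x ∈ S → S ⊆ Top → disagreement R Q S < ∣ S ∣
  disagreement<-⊆Top {S} x∈S S⊆Top with 𝒬.M-nonempty x∈S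
  ... | q , q∈MQ = disagreement< R Q (M⊆ Q S q∈MQ) (x∈p∧x∈q⇒x∉p△q q∈MR q∈MQ)
    where
    q∈MR : q ∈ M S R
    q∈MR = ℛ.M-intro (M⊆ Q S q∈MQ) (λ _ → Top-greatest (S⊆Top (M⊆ Q S q∈MQ)))

  disagreement<-Indifferent : ∀ {S x} → x ∈ S → Indifferent Q S → disagreement R Q S < ∣ S ∣
  disagreement<-Indifferent {S} x∈S indifferent with ℛ.M-nonempty x∈S
  ... | r , r∈MR = disagreement< R Q (M⊆ R S r∈MR) (x∈p∧x∈q⇒x∉p△q r∈MR (indifferent (M⊆ R S r∈MR)))

  disagreement<-⊇Top : ∀ {S} → Top ⊆ S → ¬ Indifferent Q (S ─ Top) → disagreement R Q S < ∣ S ∣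
  disagreement<-⊇Top {S} Top⊆S ¬indifferent with p⊈q⇒∃∈p∉q ¬indifferent
  ... | x , x∈S─Top , x∉M[S─Top] = disagreement< R Q x∈S (x∉p∧x∉q⇒x∉p△q x∉MR x∉MQ)
    where
    x∈S = p─q⊆p S Top x∈S─Top
    x∉MQ : x ∉ M S Q
    x∉MQ = x∉M[S─Top] ∘ 𝒬.M-antitone (p─q⊆p S Top) x∈S─Top
    x∉MR : x ∉ M S R
    x∉MR = x∈p─q⇒x∉q S Top x∈S─Top ∘ M⊆Top Top⊆S

  ⊆Top⇒Indifferent[─Top] : ∀ {S} → S ⊆ Top → Indifferent Q (S ─ Top)
  ⊆Top⇒Indifferent[─Top] {S} S⊆Top = Empty⇒Indifferent {Q = Q} {U = S ─ Top} λ (_ , x∈S─Top) →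
    x∈p─q⇒x∉q S Top x∈S─Top (S⊆Top (p─q⊆p S Top x∈S─Top))

  deficit : Subset n → ℕ
  deficit S = 𝟙[ S ⊆? Top ]
            + (𝟙[ S ⊆? ∁ Top ×-dec indifferent? Q S ] + 𝟙[ Top ⊆? S ×-dec ¬? (indifferent? Q (S ─ Top)) ])

  deficit+disagreement≤∣S∣ : ∀ {S x} → x ∈ S → deficit S + disagreement R Q S ≤ ∣ S ∣
  deficit+disagreement≤∣S∣ {S} {x} x∈S
    with S ⊆? Top | S ⊆? ∁ Top | Top ⊆? S | indifferent? Q S | indifferent? Q (S ─ Top)
  ... | yes S⊆Top | yes S⊆∁Top | _ | _ | _ = contradiction (S⊆Top x∈S) (x∈∁p⇒x∉p (S⊆∁Top x∈S))
  ... | yes S⊆Top | no _ | no _ | _ | _ = disagreement<-⊆Top x∈S S⊆Top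
  ... | yes S⊆Top | no _ | yes _ | _ | yes _ = disagreement<-⊆Top x∈S S⊆Top
  ... | yes S⊆Top | no _ | yes _ | _ | no ¬indifferent = ⊥-elim (¬indifferent (⊆Top⇒Indifferent[─Top] S⊆Top))
  ... | no _ | yes S⊆∁Top | yes Top⊆S | _ | _ =
    let (t , t∈Top) = Top-nonempty x in ⊥-elim (x∈∁p⇒x∉p (S⊆∁Top (Top⊆S t∈Top)) t∈Top)
  ... | no _ | yes _ | no _ | yes indifferent | _ = disagreement<-Indifferent x∈S indifferent
  ... | no _ | yes _ | no _ | no _ | _ = disagreement≤ R Q S
  ... | no _ | no _ | no _ | _ | _ = disagreement≤ R Q S
  ... | no _ | no _ | yes _ | _ | yes _ = disagreement≤ R Q S
  ... | no _ | no _ | yes Top⊆S | _ | no ¬indifferent = disagreement<-⊇Top Top⊆S ¬indifferent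

  deficit+disagreement≤ : ∀ S → deficit S + disagreement R Q S ≤ 2 * 𝟙[ S ⊆? ⊥ ] + ∣ S ∣
  deficit+disagreement≤ S with S ⊆? ⊥
  ... | yes S⊆⊥ = +-mono-≤ deficit≤2 (disagreement≤ R Q S)
    where
    ¬below : ¬ (Top ⊆ S × ¬ Indifferent Q (S ─ Top))
    ¬below (_ , ¬indifferent) = ¬indifferent (⊆Top⇒Indifferent[─Top] (⊆-trans S⊆⊥ ⊥⊆))
    deficit≤2 : deficit S ≤ 2
    deficit≤2 = +-mono-≤ (𝟙≤1 (S ⊆? Top)) (+-mono-≤ (𝟙≤1 (S ⊆? ∁ Top ×-dec indifferent? Q S))
      (≤-reflexive (𝟙-no ¬below (Top ⊆? S ×-dec ¬? (indifferent? Q (S ─ Top))))))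
  ... | no S⊈⊥ = deficit+disagreement≤∣S∣ (proj₁ (proj₂ (p⊈q⇒∃∈p∉q S⊈⊥)))

  D-upper : 2 ^ ∣ Top ∣ + 2 ^ ∣ ∁ Top ∣ + D R Q ≤ 2 + sumSubsets {n} ∣_∣
  D-upper = begin
    2 ^ ∣ Top ∣ + 2 ^ ∣ ∁ Top ∣ + D R Q
      ≡⟨ cong₂ _+_ (cong₂ _+_ (sym (sumSubsets-⊆ Top)) (sym (sumSubsets-⊆∁-⊇ Top (indifferent? Q))))
                   (D≡sumSubsets-disagreement R Q) ⟩
    ∑ below-Top + (∑ indifferent-outside-Top + ∑ non-indifferent-above-Top) + ∑ (disagreement R Q)
      ≡⟨ cong (λ k → ∑ below-Top + k + ∑ (disagreement R Q))
              (sym (sumSubsets-+ indifferent-outside-Top non-indifferent-above-Top)) ⟩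
    ∑ below-Top + ∑ (λ S → indifferent-outside-Top S + non-indifferent-above-Top S) + ∑ (disagreement R Q)
      ≡⟨ cong (_+ ∑ (disagreement R Q)) (sym (sumSubsets-+ below-Top _)) ⟩
    ∑ deficit + ∑ (disagreement R Q)
      ≡⟨ sym (sumSubsets-+ deficit (disagreement R Q)) ⟩
    ∑ (λ S → deficit S + disagreement R Q S)
      ≤⟨ sumSubsets-mono-≤ deficit+disagreement≤ ⟩
    ∑ (λ S → 2 * 𝟙[ S ⊆? ⊥ ] + ∣ S ∣)
      ≡⟨ sumSubsets-+ {n} (λ S → 2 * 𝟙[ S ⊆? ⊥ ]) ∣_∣ ⟩
    ∑ (λ S → 2 * 𝟙[ S ⊆? ⊥ ]) + ∑ ∣_∣
      ≡⟨ cong (_+ ∑ ∣_∣) (sumSubsets-2*𝟙[⊆⊥] {n}) ⟩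
    2 + ∑ ∣_∣ ∎
    where
    open ≤-Reasoning
    ∑ : (Subset n → ℕ) → ℕ
    ∑ = sumSubsets
    below-Top indifferent-outside-Top non-indifferent-above-Top : Subset n → ℕ
    below-Top S = 𝟙[ S ⊆? Top ]
    indifferent-outside-Top S = 𝟙[ S ⊆? ∁ Top ×-dec indifferent? Q S ]
    non-indifferent-above-Top S = 𝟙[ Top ⊆? S ×-dec ¬? (indifferent? Q (S ─ Top)) ]

rankedBy : (Fin n → ℕ) → BRel n
rankedBy ρ x y = ρ y ≤ᵇ ρ x

module _ (ρ : Fin n → ℕ) where

  rankedBy-isTotalPre : IsTotalPre (rankedBy ρ)
  rankedBy-isTotalPre = record
    { isPreorder = record
      { isEquivalence = isEquivalence
      ; reflexive = λ { {x} refl → ≤⇒≤ᵇ (≤-refl {ρ x}) }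
      ; trans = λ {x} {y} {z} Rxy Ryz → ≤⇒≤ᵇ (≤-trans (≤ᵇ⇒≤ (ρ z) (ρ y) Ryz) (≤ᵇ⇒≤ (ρ y) (ρ x) Rxy))
      }
    ; total = λ x y → Sum.map ≤⇒≤ᵇ ≤⇒≤ᵇ (≤-total (ρ y) (ρ x))
    }

  private
    module ρ = MaximalElements rankedBy-isTotalPre

  rankedBy-M-intro : ∀ {S x} → x ∈ S → (∀ {y} → y ∈ S → ρ y ≤ ρ x) → x ∈ M S (rankedBy ρ)
  rankedBy-M-intro x∈S ρ≤ρx = ρ.M-intro x∈S (≤⇒≤ᵇ ∘ ρ≤ρx)

  rankedBy-M-maximal : ∀ {S x y} → x ∈ M S (rankedBy ρ) → y ∈ S → ρ y ≤ ρ x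
  rankedBy-M-maximal {x = x} {y} x∈M y∈S = ≤ᵇ⇒≤ (ρ y) (ρ x) (ρ.M-maximal x∈M y∈S)

topRank : Subset n → Fin n → ℕ
topRank {n} B x = if does (x ∈? B) then n else toℕ x

withTop : Subset n → BRel n
withTop B = rankedBy (topRank B)

module _ {B : Subset n} where

  topRank-∈ : ∀ {x} → x ∈ B → topRank B x ≡ n
  topRank-∈ {x} x∈B with x ∈? B
  ... | yes _ = refl
  ... | no x∉B = contradiction x∈B x∉B

  topRank-∉ : ∀ {x} → x ∉ B → topRank B x ≡ toℕ x
  topRank-∉ {x} x∉B with x ∈? B
  ... | yes x∈B = contradiction x∈B x∉B
  ... | no _ = refl

  topRank≤n : ∀ x → topRank B x ≤ n
  topRank≤n x with x ∈? B
  ... | yes _ = ≤-refl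
  ... | no _ = <⇒≤ (toℕ<n x)

  ∈B⇒∈M : ∀ {S x} → x ∈ S → x ∈ B → x ∈ M S (withTop B)
  ∈B⇒∈M {x = x} x∈S x∈B = rankedBy-M-intro (topRank B) x∈S λ {y} _ →
    subst (topRank B y ≤_) (sym (topRank-∈ x∈B)) (topRank≤n y)

  ∉B⇒∉M : ∀ {S x y} → y ∈ S → y ∈ B → x ∉ B → x ∉ M S (withTop B)
  ∉B⇒∉M {x = x} y∈S y∈B x∉B x∈M = <⇒≱ (toℕ<n x)
    (subst₂ _≤_ (topRank-∈ y∈B) (topRank-∉ x∉B) (rankedBy-M-maximal (topRank B) x∈M y∈S))

  ∣M∣≤1 : ∀ {S} → (∀ {x} → x ∈ S → x ∉ B) → ∣ M S (withTop B) ∣ ≤ 1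
  ∣M∣≤1 {S} S∩B≡∅ = ∣p∣≤1 (M S (withTop B)) λ x∈M y∈M → toℕ-injective (≤-antisym
    (ranks≤ y∈M x∈M) (ranks≤ x∈M y∈M))
    where
    ranks≤ : ∀ {x y} → x ∈ M S (withTop B) → y ∈ M S (withTop B) → toℕ y ≤ toℕ x
    ranks≤ x∈M y∈M = subst₂ _≤_ (topRank-∉ (S∩B≡∅ y∈S)) (topRank-∉ (S∩B≡∅ x∈S))
      (rankedBy-M-maximal (topRank B) x∈M y∈S)
      where
      x∈S = M⊆ (withTop B) S x∈M
      y∈S = M⊆ (withTop B) S y∈M

module LowerBound (A : Subset n) where

  private
    R Q : BRel n
    R = withTop A
    Q = withTop (∁ A)

  2*𝟙[⊆⊥]+∣S∣≤ : ∀ S → 2 * 𝟙[ S ⊆? ⊥ ] + ∣ S ∣ ≤ 𝟙[ S ⊆? A ] + 𝟙[ S ⊆? ∁ A ] + disagreement R Q S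
  2*𝟙[⊆⊥]+∣S∣≤ S with S ⊆? A | S ⊆? ∁ A | S ⊆? ⊥
  ... | yes S⊆A | yes S⊆∁A | S⊆?⊥ = +-mono-≤ (*-monoʳ-≤ 2 (𝟙≤1 S⊆?⊥)) (≤-trans ∣S∣≤0 z≤n)
    where
    ∣S∣≤0 : ∣ S ∣ ≤ 0
    ∣S∣≤0 = ≤-trans (p⊆q⇒∣p∣≤∣q∣ {q = ⊥} λ x∈S → contradiction (S⊆A x∈S) (x∈∁p⇒x∉p (S⊆∁A x∈S)))
                    (≤-reflexive (∣⊥∣≡0 n))
  ... | no S⊈A | _ | yes S⊆⊥ = ⊥-elim (S⊈A (⊆-trans S⊆⊥ ⊥⊆))
  ... | yes _ | no S⊈∁A | yes S⊆⊥ = ⊥-elim (S⊈∁A (⊆-trans S⊆⊥ ⊥⊆))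
  ... | yes S⊆A | no _ | no _ = ≤-trans
    (s⊆p⇒∣s∣≤∣q∣+∣p△q∣ {p = M S R} {M S Q} λ x∈S → ∈B⇒∈M x∈S (S⊆A x∈S))
    (+-monoˡ-≤ (disagreement R Q S) (∣M∣≤1 (x∈p⇒x∉∁p ∘ S⊆A)))
  ... | no _ | yes S⊆∁A | no _ = ≤-trans
    (s⊆q⇒∣s∣≤∣p∣+∣p△q∣ {p = M S R} {M S Q} λ x∈S → ∈B⇒∈M x∈S (S⊆∁A x∈S))
    (+-monoˡ-≤ (disagreement R Q S) (∣M∣≤1 (x∈∁p⇒x∉p ∘ S⊆∁A)))
  ... | no S⊈A | no S⊈∁A | no _ with p⊈q⇒∃∈p∉q S⊈A | p⊈q⇒∃∈p∉q S⊈∁A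
  ...   | a , a∈S , a∉A | b , b∈S , b∉∁A = p⊆q⇒∣p∣≤∣q∣ S⊆M△M
    where
    S⊆M△M : S ⊆ M S R △ M S Q
    S⊆M△M {x} x∈S with x ∈? A
    ... | yes x∈A = x∈p∧x∉q⇒x∈p△q (∈B⇒∈M x∈S x∈A) (∉B⇒∉M a∈S (x∉p⇒x∈∁p a∉A) (x∈p⇒x∉∁p x∈A))
    ... | no x∉A = x∉p∧x∈q⇒x∈p△q (∉B⇒∉M b∈S (x∉∁p⇒x∈p b∉∁A) x∉A) (∈B⇒∈M x∈S (x∉p⇒x∈∁p x∉A))

  D-lower : 2 + sumSubsets {n} ∣_∣ ≤ 2 ^ ∣ A ∣ + 2 ^ ∣ ∁ A ∣ + D R Q
  D-lower = begin
    2 + ∑ ∣_∣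
      ≡⟨ cong (_+ ∑ ∣_∣) (sym (sumSubsets-2*𝟙[⊆⊥] {n})) ⟩
    ∑ (λ S → 2 * 𝟙[ S ⊆? ⊥ ]) + ∑ ∣_∣
      ≡⟨ sym (sumSubsets-+ {n} (λ S → 2 * 𝟙[ S ⊆? ⊥ ]) ∣_∣) ⟩
    ∑ (λ S → 2 * 𝟙[ S ⊆? ⊥ ] + ∣ S ∣)
      ≤⟨ sumSubsets-mono-≤ 2*𝟙[⊆⊥]+∣S∣≤ ⟩
    ∑ (λ S → 𝟙[ S ⊆? A ] + 𝟙[ S ⊆? ∁ A ] + disagreement R Q S)
      ≡⟨ sumSubsets-+ (λ S → 𝟙[ S ⊆? A ] + 𝟙[ S ⊆? ∁ A ]) (disagreement R Q) ⟩
    ∑ (λ S → 𝟙[ S ⊆? A ] + 𝟙[ S ⊆? ∁ A ]) + ∑ (disagreement R Q)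
      ≡⟨ cong₂ _+_ (sumSubsets-+ (λ S → 𝟙[ S ⊆? A ]) (λ S → 𝟙[ S ⊆? ∁ A ])) (sym (D≡sumSubsets-disagreement R Q)) ⟩
    ∑ (λ S → 𝟙[ S ⊆? A ]) + ∑ (λ S → 𝟙[ S ⊆? ∁ A ]) + D R Q
      ≡⟨ cong (_+ D R Q) (cong₂ _+_ (sumSubsets-⊆ A) (sumSubsets-⊆ (∁ A))) ⟩
    2 ^ ∣ A ∣ + 2 ^ ∣ ∁ A ∣ + D R Q ∎
    where
    open ≤-Reasoning
    ∑ : (Subset n → ℕ) → ℕ
    ∑ = sumSubsets

2^⌊n/2⌋+2^⌈n/2⌉≤2^n+1 : ∀ n → 2 ^ ⌊ n /2⌋ + 2 ^ ⌈ n /2⌉ ≤ 2 ^ n + 1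
2^⌊n/2⌋+2^⌈n/2⌉≤2^n+1 zero = ≤-refl
2^⌊n/2⌋+2^⌈n/2⌉≤2^n+1 (suc zero) = ≤-refl
2^⌊n/2⌋+2^⌈n/2⌉≤2^n+1 (suc (suc n)) = begin
  2 * 2 ^ ⌊ n /2⌋ + 2 * 2 ^ ⌈ n /2⌉ ≡⟨ sym (*-distribˡ-+ 2 (2 ^ ⌊ n /2⌋) (2 ^ ⌈ n /2⌉)) ⟩
  2 * (2 ^ ⌊ n /2⌋ + 2 ^ ⌈ n /2⌉)   ≤⟨ *-monoʳ-≤ 2 (2^⌊n/2⌋+2^⌈n/2⌉≤2^n+1 n) ⟩
  2 * (2 ^ n + 1)                   ≡⟨ *-distribˡ-+ 2 (2 ^ n) 1 ⟩
  k + 2                             ≡⟨ +-comm k 2 ⟩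
  2 + k                             ≡⟨ cong suc (+-comm 1 k) ⟩
  1 + k + 1                         ≤⟨ +-monoˡ-≤ 1 (+-monoˡ-≤ k (m^n>0 2 (suc n))) ⟩
  k + k + 1                         ≡⟨ cong (λ l → k + l + 1) (sym (+-identityʳ k)) ⟩
  2 * k + 1 ∎
  where
  open ≤-Reasoning
  k = 2 ^ suc n

2^⌊a+b/2⌋+2^⌈a+b/2⌉≤2^a+2^b : ∀ a b → 2 ^ ⌊ (a + b) /2⌋ + 2 ^ ⌈ (a + b) /2⌉ ≤ 2 ^ a + 2 ^ b
2^⌊a+b/2⌋+2^⌈a+b/2⌉≤2^a+2^b zero b = ≤-trans (2^⌊n/2⌋+2^⌈n/2⌉≤2^n+1 b) (≤-reflexive (+-comm (2 ^ b) 1))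
2^⌊a+b/2⌋+2^⌈a+b/2⌉≤2^a+2^b (suc a) zero =
  subst (λ n → 2 ^ ⌊ n /2⌋ + 2 ^ ⌈ n /2⌉ ≤ 2 ^ suc a + 1) (sym (+-identityʳ (suc a))) (2^⌊n/2⌋+2^⌈n/2⌉≤2^n+1 (suc a))
2^⌊a+b/2⌋+2^⌈a+b/2⌉≤2^a+2^b (suc a) (suc b) rewrite +-suc a b = begin
  2 * 2 ^ ⌊ (a + b) /2⌋ + 2 * 2 ^ ⌈ (a + b) /2⌉ ≡⟨ sym (*-distribˡ-+ 2 (2 ^ ⌊ (a + b) /2⌋) (2 ^ ⌈ (a + b) /2⌉)) ⟩
  2 * (2 ^ ⌊ (a + b) /2⌋ + 2 ^ ⌈ (a + b) /2⌉)   ≤⟨ *-monoʳ-≤ 2 (2^⌊a+b/2⌋+2^⌈a+b/2⌉≤2^a+2^b a b) ⟩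
  2 * (2 ^ a + 2 ^ b)                           ≡⟨ *-distribˡ-+ 2 (2 ^ a) (2 ^ b) ⟩
  2 * 2 ^ a + 2 * 2 ^ b ∎
  where open ≤-Reasoning

alternating : ∀ n → Subset n
alternating zero = []
alternating (suc zero) = outside ∷ []
alternating (suc (suc n)) = outside ∷ inside ∷ alternating n

∣alternating∣ : ∀ n → ∣ alternating n ∣ ≡ ⌊ n /2⌋
∣alternating∣ zero = refl
∣alternating∣ (suc zero) = refl
∣alternating∣ (suc (suc n)) = cong suc (∣alternating∣ n)

∣∁alternating∣ : ∀ n → ∣ ∁ (alternating n) ∣ ≡ ⌈ n /2⌉
∣∁alternating∣ zero = refl
∣∁alternating∣ (suc zero) = refl
∣∁alternating∣ (suc (suc n)) = cong suc (∣∁alternating∣ n)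

maxD-suc : ∀ m → maxD (suc m) ≡ 2 + sumSubsets {suc m} ∣_∣ ∸ (2 ^ ⌊ suc m /2⌋ + 2 ^ ⌈ suc m /2⌉)
maxD-suc m = trans (∸-+-assoc (suc m * 2 ^ m + 2) (2 ^ ⌊ suc m /2⌋) (2 ^ ⌈ suc m /2⌉))
  (cong (_∸ (2 ^ ⌊ suc m /2⌋ + 2 ^ ⌈ suc m /2⌉)) (trans (+-comm (suc m * 2 ^ m) 2) (cong (2 +_) (sym (sumSubsets-size m)))))

D≤maxD : ∀ m {R Q : BRel (suc m)} → IsTotalPre R → IsTotalPre Q → D R Q ≤ maxD (suc m)
D≤maxD m {R} {Q} R-total Q-total = subst (D R Q ≤_) (sym (maxD-suc m)) (m+n≤o⇒m≤o∸n (D R Q) (begin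
  D R Q + (2 ^ ⌊ suc m /2⌋ + 2 ^ ⌈ suc m /2⌉) ≡⟨ +-comm (D R Q) _ ⟩
  2 ^ ⌊ suc m /2⌋ + 2 ^ ⌈ suc m /2⌉ + D R Q   ≤⟨ +-monoˡ-≤ (D R Q) balanced≤ ⟩
  2 ^ ∣ Top ∣ + 2 ^ ∣ ∁ Top ∣ + D R Q         ≤⟨ D-upper ⟩
  2 + sumSubsets {suc m} ∣_∣ ∎))
  where
  open UpperBound R-total Q-total using (Top; D-upper)
  open ≤-Reasoning
  balanced≤ : 2 ^ ⌊ suc m /2⌋ + 2 ^ ⌈ suc m /2⌉ ≤ 2 ^ ∣ Top ∣ + 2 ^ ∣ ∁ Top ∣
  balanced≤ = subst (λ n → 2 ^ ⌊ n /2⌋ + 2 ^ ⌈ n /2⌉ ≤ 2 ^ ∣ Top ∣ + 2 ^ ∣ ∁ Top ∣) (∣p∣+∣∁p∣≡n Top)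
    (2^⌊a+b/2⌋+2^⌈a+b/2⌉≤2^a+2^b ∣ Top ∣ ∣ ∁ Top ∣)

maxD≤D-alternating : ∀ m → let A = alternating (suc m) in maxD (suc m) ≤ D (withTop A) (withTop (∁ A))
maxD≤D-alternating m = subst (_≤ D (withTop A) (withTop (∁ A))) (sym (maxD-suc m))
  (m≤n+o⇒m∸n≤o (2 + sumSubsets {suc m} ∣_∣) (2 ^ ⌊ suc m /2⌋ + 2 ^ ⌈ suc m /2⌉)
    (subst (λ k → 2 + sumSubsets {suc m} ∣_∣ ≤ k + D (withTop A) (withTop (∁ A)))
      (cong₂ (λ a b → 2 ^ a + 2 ^ b) (∣alternating∣ (suc m)) (∣∁alternating∣ (suc m)))
      D-lower))
  where
  A = alternating (suc m)
  open LowerBound A using (D-lower)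

theorem4p1 : (n : ℕ) → 2 ≤ n →
    (Σ (BRel n) λ R → Σ (BRel n) λ Q →
       IsTotalPre R × IsTotalPre Q × D R Q ≡ maxD n)
    × ((R Q : BRel n) → IsTotalPre R → IsTotalPre Q → D R Q ≤ maxD n)
theorem4p1 (suc m) _ =
  (withTop A , withTop (∁ A) , A-total , ∁A-total , ≤-antisym (D≤maxD m A-total ∁A-total) (maxD≤D-alternating m))
  , λ R Q → D≤maxD m
  where
  A = alternating (suc m)
  A-total = rankedBy-isTotalPre (topRank A)
  ∁A-total = rankedBy-isTotalPre (topRank (∁ A))
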